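{- In the discrete data-center optimization problem, let $X^{\mathrm{LCP}}=(x^{\mathrm{LCP}}_1,\dots,x^{\mathrm{LCP}}_T)$ be the schedule of the LCP algorithm and let $X^\ast=(x^\ast_1,\dots,x^\ast_T)$ be the schedule defined by $x^\ast_{T+1}=0$ and $x^\ast_t=\max\{x^L_t,\min\{x^U_t,x^\ast_{t+1}\}\}$ for $t=T,\dots,1$. Then $S^L_T(X^{\mathrm{LCP}})\le S^L_T(X^\ast)$, where $S^L_T(X)=\beta\sum_{t=1}^T(x_t-x_{t-1})^+$ with $x_0=0$.
   Context: Discrete data-center optimization problem: given $T,m\in\mathbb{N}$, $\beta>0$ and convex functions $f_1,\dots,f_T:\{0,\dots,m\}\to\mathbb{R}_{\ge0}$ (convex meaning $f_t(x+1)-f_t(x)$ nondecreasing); schedules are $X\in\{0,\dots,m\}^T$, $x_0=0$, $(y)^+=\max(0,y)$. For $\tau\in\{1,\dots,T\}$ and $X=(x_1,\dots,x_\tau)$ define $C^L_\tau(X)=\sum_{t=1}^\tau f_t(x_t)+\beta\sum_{t=1}^\tau(x_t-x_{t-1})^+$ and $C^U_\tau(X)=\sum_{t=1}^\tau f_t(x_t)+\beta\sum_{t=1}^\tau(x_{t-1}-x_t)^+$. Let $x^L_\tau$ be the smallest last component among all minimizers of $C^L_\tau$ over $\{0,\dots,m\}^\tau$, and $x^U_\tau$ the largest last component among all minimizers of $C^U_\tau$. The LCP (Lazy Capacity Provisioning) algorithm sets $x^{\mathrm{LCP}}_0=0$ and $x^{\mathrm{LCP}}_\tau=\max\{x^L_\tau,\min\{x^U_\tau,x^{\mathrm{LCP}}_{\tau-1}\}\}$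 for $\tau\ge1$.
   Formalization: The values of the cost functions $f_1,\dots,f_T$ and the constant β are rational rather than real. -}

module Defs where

open import Data.Nat as ℕ using (ℕ; zero; suc; _∸_; _⊔_; _⊓_)
open import Data.Integer using (+_)
open import Data.Rational using (ℚ; 0ℚ; _+_; _*_; _-_; _/_; _≤_; _<_)
open import Data.Product using (Σ; _×_; _,_)
open import Relation.Binary.PropositionalEquality using (_≡_)

toℚ : ℕ → ℚ
toℚ n = + n / 1

-- A schedule is a function X : ℕ → ℕ; only X 1, …, X τ matter.
-- The value at time 0 is fixed to 0 (x₀ = 0) via `prev`.
prev : (ℕ → ℕ) → ℕ → ℕ
prev X zero    = 0
prev X (suc t) = X (suc t)

-- Cost functions: f t x is f_t(x) for 1 ≤ t ≤ T, 0 ≤ x ≤ m.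
module Problem (T m : ℕ) (β : ℚ) (f : ℕ → ℕ → ℚ) where

  Valid : ℕ → (ℕ → ℕ) → Set
  Valid τ X = ∀ t → 1 ℕ.≤ t → t ℕ.≤ τ → X t ℕ.≤ m

  CL : ℕ → (ℕ → ℕ) → ℚ
  CL zero    X = 0ℚ
  CL (suc τ) X = CL τ X + (f (suc τ) (X (suc τ)) + β * toℚ (X (suc τ) ∸ prev X τ))

  CU : ℕ → (ℕ → ℕ) → ℚ
  CU zero    X = 0ℚ
  CU (suc τ) X = CU τ X + (f (suc τ) (X (suc τ)) + β * toℚ (prev X τ ∸ X (suc τ)))

  SL : ℕ → (ℕ → ℕ) → ℚ
  SL zero    X = 0ℚ
  SL (suc τ) X = SL τ X + β * toℚ (X (suc τ) ∸ prev X τ)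

  MinimizerL : ℕ → (ℕ → ℕ) → Set
  MinimizerL τ X = Valid τ X × (∀ Y → Valid τ Y → CL τ X ≤ CL τ Y)

  MinimizerU : ℕ → (ℕ → ℕ) → Set
  MinimizerU τ X = Valid τ X × (∀ Y → Valid τ Y → CU τ X ≤ CU τ Y)

  IsXL : ℕ → ℕ → Set
  IsXL τ v = Σ (ℕ → ℕ) (λ X → MinimizerL τ X × X τ ≡ v)
           × (∀ X → MinimizerL τ X → v ℕ.≤ X τ)

  IsXU : ℕ → ℕ → Set
  IsXU τ v = Σ (ℕ → ℕ) (λ X → MinimizerU τ X × X τ ≡ v)
           × (∀ X → MinimizerU τ X → X τ ℕ.≤ v)

  Nonneg : Set
  Nonneg = ∀ t x → 1 ℕ.≤ t → t ℕ.≤ T → x ℕ.≤ m → 0ℚ ≤ f t x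

  Convex : Set
  Convex = ∀ t x → 1 ℕ.≤ t → t ℕ.≤ T → suc (suc x) ℕ.≤ m →
           f t (suc x) - f t x ≤ f t (suc (suc x)) - f t (suc x)

  -- schedules built from given sequences xL, xU (intended: x^L_τ, x^U_τ)
  module Schedules (xL xU : ℕ → ℕ) where

    xLCP : ℕ → ℕ
    xLCP zero    = 0
    xLCP (suc τ) = xL (suc τ) ⊔ (xU (suc τ) ⊓ xLCP τ)

    -- backward recursion: back k is x*_{T+1−k}; back 0 = x*_{T+1} = 0
    back : ℕ → ℕ
    back zero    = 0
    back (suc k) = xL (T ∸ k) ⊔ (xU (T ∸ k) ⊓ back k)

    xStar : ℕ → ℕ
    xStar t = back (suc (T ∸ t))

-- LCP moves from its previous value p to x = xL ⊔ (xU ⊓ p), and x lies between p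
-- and every value y = xL ⊔ (xU ⊓ q) that any other schedule of the same shape (such
-- as X*) can take at that time: it moves up only to the lower bound xL ≤ y and down
-- only to xL ⊔ xU ≥ y. Hence the potential "upward movement of LCP so far plus the
-- gap (y_t − x_t)⁺" never exceeds the upward movement of the other schedule.
module Submission where

open import Data.Nat as ℕ using (ℕ; zero; suc; _∸_; _⊔_; _⊓_; _<_; z≤n)
open import Data.Nat.Properties as ℕP
  using (<-cmp; m≤n⇒m∸n≡0; +-∸-comm; m+[n∸m]≡n; m≤n+m∸n; m∸n≤m; n≤1+n; m∸[m∸n]≡n;
         ⊔-sel; ⊓-sel; m≤m⊔n; m≤n⊔m; m⊓n≤m; m⊓n≤n; ⊔-monoʳ-≤; m≤m+n; <⇒≱)
import Data.Integer as ℤ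
open import Data.Integer using (+_)
import Data.Integer.Properties as ℤP
open import Data.Rational using (ℚ; 0ℚ; _+_; _*_; _≤_; toℚᵘ; nonNegative)
  renaming (_<_ to _<ℚ_)
open import Data.Rational.Properties as ℚP
  using (toℚᵘ-injective; toℚᵘ-fromℚᵘ; toℚᵘ-homo-+; +-monoʳ-≤; +-identityʳ; *-zeroʳ;
         *-distribˡ-+; *-monoˡ-≤-nonNeg; nonNegative⁻¹; normalize-nonNeg; <⇒≤)
import Data.Rational.Unnormalised as ℚᵘ
import Data.Rational.Unnormalised.Properties as ℚᵘP
open import Data.Product using (∃-syntax; _×_; _,_)
open import Data.Sum using (_⊎_; inj₁; inj₂)
open import Function using (_∘_)
open import Relation.Nullary using (contradiction)
open import Relation.Binary.Definitions using (tri<; tri≈; tri>)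
open import Relation.Binary.PropositionalEquality
open import Defs

toℚ-+ : ∀ a b → toℚ (a ℕ.+ b) ≡ toℚ a + toℚ b
toℚ-+ a b = toℚᵘ-injective (begin
  toℚᵘ (toℚ (a ℕ.+ b))                 ≈⟨ toℚᵘ-fromℚᵘ (ℚᵘ.mkℚᵘ (+ (a ℕ.+ b)) 0) ⟩
  ℚᵘ.mkℚᵘ (+ (a ℕ.+ b)) 0              ≈⟨ ℚᵘ.*≡* integer-sum ⟩
  ℚᵘ.mkℚᵘ (+ a) 0 ℚᵘ.+ ℚᵘ.mkℚᵘ (+ b) 0 ≈⟨ ℚᵘP.+-cong (ℚᵘP.≃-sym (toℚᵘ-fromℚᵘ (ℚᵘ.mkℚᵘ (+ a) 0)))
                                                      (ℚᵘP.≃-sym (toℚᵘ-fromℚᵘ (ℚᵘ.mkℚᵘ (+ b) 0))) ⟩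
  toℚᵘ (toℚ a) ℚᵘ.+ toℚᵘ (toℚ b)       ≈⟨ ℚᵘP.≃-sym (toℚᵘ-homo-+ (toℚ a) (toℚ b)) ⟩
  toℚᵘ (toℚ a + toℚ b)                 ∎)
  where
  open ℚᵘP.≃-Reasoning
  integer-sum : + (a ℕ.+ b) ℤ.* + 1 ≡ (+ a ℤ.* + 1 ℤ.+ + b ℤ.* + 1) ℤ.* + 1
  integer-sum rewrite ℤP.*-identityʳ (+ a) | ℤP.*-identityʳ (+ b) = refl

toℚ-mono-≤ : ∀ {a b} → a ℕ.≤ b → toℚ a ≤ toℚ b
toℚ-mono-≤ {a} {b} a≤b = begin
  toℚ a                 ≡⟨ +-identityʳ (toℚ a) ⟨
  toℚ a + 0ℚ            ≤⟨ +-monoʳ-≤ (toℚ a) (nonNegative⁻¹ _ {{normalize-nonNeg (b ∸ a) 1}}) ⟩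
  toℚ a + toℚ (b ∸ a)   ≡⟨ toℚ-+ a (b ∸ a) ⟨
  toℚ (a ℕ.+ (b ∸ a))   ≡⟨ cong toℚ (m+[n∸m]≡n a≤b) ⟩
  toℚ b                 ∎
  where open ℚP.≤-Reasoning

clamp : ℕ → ℕ → ℕ → ℕ
clamp l u p = l ⊔ (u ⊓ p)

l≤clamp : ∀ l u p → l ℕ.≤ clamp l u p
l≤clamp l u p = m≤m⊔n l (u ⊓ p)

clamp≤l⊔u : ∀ l u p → clamp l u p ℕ.≤ l ⊔ u
clamp≤l⊔u l u p = ⊔-monoʳ-≤ l (m⊓n≤m u p)

clamp<p⇒clamp≡l⊔u : ∀ l u p → clamp l u p < p → clamp l u p ≡ l ⊔ u
clamp<p⇒clamp≡l⊔u l u p x<p with ⊓-sel u p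
... | inj₁ u⊓p≡u = cong (l ⊔_) u⊓p≡u
... | inj₂ u⊓p≡p = contradiction (subst (ℕ._≤ clamp l u p) u⊓p≡p (m≤n⊔m l (u ⊓ p))) (<⇒≱ x<p)

p<clamp⇒clamp≡l : ∀ l u p → p < clamp l u p → clamp l u p ≡ l
p<clamp⇒clamp≡l l u p p<x with ⊔-sel l (u ⊓ p)
... | inj₁ x≡l   = x≡l
... | inj₂ x≡u⊓p = contradiction (subst (ℕ._≤ p) (sym x≡u⊓p) (m⊓n≤n u p)) (<⇒≱ p<x)

Between : ℕ → ℕ → ℕ → Set
Between p x y = (p ℕ.≤ x × x ℕ.≤ y) ⊎ (y ℕ.≤ x × x ℕ.≤ p)

clamp-between : ∀ l u p q → Between p (clamp l u p) (clamp l u q)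
clamp-between l u p q with <-cmp (clamp l u p) p
... | tri< x<p _ _ = inj₂ (subst (clamp l u q ℕ.≤_) (sym (clamp<p⇒clamp≡l⊔u l u p x<p)) (clamp≤l⊔u l u q)
                          , ℕP.<⇒≤ x<p)
... | tri> _ _ p<x = inj₁ (ℕP.<⇒≤ p<x
                          , subst (ℕ._≤ clamp l u q) (sym (p<clamp⇒clamp≡l l u p p<x)) (l≤clamp l u q))
... | tri≈ _ x≡p _ with ℕP.≤-total p (clamp l u q)
...   | inj₁ p≤y = inj₁ (ℕP.≤-reflexive (sym x≡p) , subst (ℕ._≤ clamp l u q) (sym x≡p) p≤y)
...   | inj₂ y≤p = inj₂ (subst (clamp l u q ℕ.≤_) (sym x≡p) y≤p , ℕP.≤-reflexive x≡p)

between-∸-+-∸ : ∀ {p x y} → Between p x y → (x ∸ p) ℕ.+ (y ∸ x) ℕ.≤ y ∸ p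
between-∸-+-∸ {p} {x} {y} (inj₁ (p≤x , x≤y)) = ℕP.≤-reflexive (begin
  (x ∸ p) ℕ.+ (y ∸ x) ≡⟨ +-∸-comm (y ∸ x) p≤x ⟨
  (x ℕ.+ (y ∸ x)) ∸ p ≡⟨ cong (_∸ p) (m+[n∸m]≡n x≤y) ⟩
  y ∸ p               ∎)
  where open ≡-Reasoning
between-∸-+-∸ (inj₂ (y≤x , x≤p)) rewrite m≤n⇒m∸n≡0 x≤p | m≤n⇒m∸n≡0 y≤x = z≤n

∸-triangle : ∀ y r p → y ∸ p ℕ.≤ (r ∸ p) ℕ.+ (y ∸ r)
∸-triangle y       r       zero    = m≤n+m∸n y r
∸-triangle zero    r       (suc p) = z≤n
∸-triangle (suc y) zero    (suc p) = ℕP.≤-trans (m∸n≤m y p) (n≤1+n y)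
∸-triangle (suc y) (suc r) (suc p) = ∸-triangle y r p

ascent : (ℕ → ℕ) → ℕ → ℕ
ascent X zero    = 0
ascent X (suc t) = ascent X t ℕ.+ (X (suc t) ∸ prev X t)

module _ (T m : ℕ) (β : ℚ) (f : ℕ → ℕ → ℚ) where
  open Problem T m β f using (SL)

  SL≡β*ascent : ∀ X n → SL n X ≡ β * toℚ (ascent X n)
  SL≡β*ascent X zero    = sym (*-zeroʳ β)
  SL≡β*ascent X (suc n) = begin
    SL n X + β * toℚ (X (suc n) ∸ prev X n)                 ≡⟨ cong (_+ β * toℚ (X (suc n) ∸ prev X n)) (SL≡β*ascent X n) ⟩
    β * toℚ (ascent X n) + β * toℚ (X (suc n) ∸ prev X n)   ≡⟨ *-distribˡ-+ β _ _ ⟨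
    β * (toℚ (ascent X n) + toℚ (X (suc n) ∸ prev X n))     ≡⟨ cong (β *_) (toℚ-+ (ascent X n) _) ⟨
    β * toℚ (ascent X (suc n))                               ∎
    where open ≡-Reasoning

module LazySchedule (L U : ℕ → ℕ) {X : ℕ → ℕ}
  (X-lazy : ∀ t → X (suc t) ≡ clamp (L (suc t)) (U (suc t)) (prev X t)) where

  ClampedUpTo : ℕ → (ℕ → ℕ) → Set
  ClampedUpTo n Y = ∀ t → t < n → ∃[ q ] Y (suc t) ≡ clamp (L (suc t)) (U (suc t)) q

  ascent-+-gap-≤ : ∀ n Y → ClampedUpTo n Y → ascent X n ℕ.+ (prev Y n ∸ prev X n) ℕ.≤ ascent Y n
  ascent-+-gap-≤ zero    Y _       = z≤n
  ascent-+-gap-≤ (suc n) Y clamped = begin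
    ascent X n ℕ.+ (x ∸ p) ℕ.+ (y ∸ x)        ≡⟨ ℕP.+-assoc (ascent X n) _ _ ⟩
    ascent X n ℕ.+ ((x ∸ p) ℕ.+ (y ∸ x))      ≤⟨ ℕP.+-monoʳ-≤ (ascent X n) (between-∸-+-∸ step-between) ⟩
    ascent X n ℕ.+ (y ∸ p)                    ≤⟨ ℕP.+-monoʳ-≤ (ascent X n) (∸-triangle y r p) ⟩
    ascent X n ℕ.+ ((r ∸ p) ℕ.+ (y ∸ r))      ≡⟨ ℕP.+-assoc (ascent X n) _ _ ⟨
    ascent X n ℕ.+ (r ∸ p) ℕ.+ (y ∸ r)        ≤⟨ ℕP.+-monoˡ-≤ (y ∸ r) (ascent-+-gap-≤ n Y (λ t → clamped t ∘ ℕP.m<n⇒m<1+n)) ⟩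
    ascent Y n ℕ.+ (y ∸ r)                    ∎
    where
    open ℕP.≤-Reasoning
    p = prev X n
    r = prev Y n
    x = X (suc n)
    y = Y (suc n)
    step-between : Between p x y
    step-between with clamped n ℕP.≤-refl
    ... | q , y≡ = subst₂ (Between p) (sym (X-lazy n)) (sym y≡) (clamp-between (L (suc n)) (U (suc n)) p q)

  ascent-≤ : ∀ n Y → ClampedUpTo n Y → ascent X n ℕ.≤ ascent Y n
  ascent-≤ n Y clamped = ℕP.≤-trans (m≤m+n _ _) (ascent-+-gap-≤ n Y clamped)

lemma3p9 : (T m : ℕ) (β : ℚ) (f : ℕ → ℕ → ℚ) →
    0ℚ <ℚ β →
    Problem.Nonneg T m β f →
    Problem.Convex T m β f →
    (xL xU : ℕ → ℕ) →
    (∀ τ → 1 ℕ.≤ τ → τ ℕ.≤ T → Problem.IsXL T m β f τ (xL τ)) →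
    (∀ τ → 1 ℕ.≤ τ → τ ℕ.≤ T → Problem.IsXU T m β f τ (xU τ)) →
    Problem.SL T m β f T (Problem.Schedules.xLCP T m β f xL xU)
      ≤ Problem.SL T m β f T (Problem.Schedules.xStar T m β f xL xU)
lemma3p9 T m β f 0<β _ _ xL xU _ _ =
  subst₂ _≤_ (sym (SL≡β*ascent T m β f xLCP T)) (sym (SL≡β*ascent T m β f xStar T))
    (*-monoˡ-≤-nonNeg β {{nonNegative (<⇒≤ 0<β)}} (toℚ-mono-≤ (ascent-≤ T xStar xStar-clamped)))
  where
  open Problem.Schedules T m β f xL xU
  xLCP-lazy : ∀ t → xLCP (suc t) ≡ clamp (xL (suc t)) (xU (suc t)) (prev xLCP t)
  xLCP-lazy zero    = refl
  xLCP-lazy (suc t) = refl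
  open LazySchedule xL xU xLCP-lazy
  xStar-clamped : ClampedUpTo T xStar
  xStar-clamped t t<T =
    back (T ∸ suc t) , cong (λ s → clamp (xL s) (xU s) (back (T ∸ suc t))) (m∸[m∸n]≡n t<T)
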